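{- Let $p$ be a prime, $d\ge2$ an integer, and $\mathbb F$ the field of order $p^d$. Let $k$ and $c$ be the maximal valency and the indistinguishing number of the scheme $C(\mathbb F)$. Then $k=d$ and $c\le\sum_{i=1}^{d-1}\left(p^{\gcd(i,d)}-1\right)$.
   Context: $C(\mathbb F)$ is the coherent configuration on the point set $\mathbb F^\times$ whose basis relations are the sets $\{(ax^\sigma,ay^\sigma):a\in\mathbb F^\times,\sigma\in\mathrm{Aut}(\mathbb F)\}$, $x,y\in\mathbb F^\times$. For a coherent configuration $(\Omega,S)$ with intersection numbers $c_{rs}^t$: the valency of $s\in S$ is $n_s=|\{\beta:(\alpha,\beta)\in s\}|$ for any $\alpha$ for which this set is nonempty, and the maximal valency is $\max_s n_s$; for $s\in S$ and any $(\alpha,\beta)\in s$, $c(s)=|\{\gamma\in\Omega:r(\gamma,\alpha)=r(\gamma,\beta)\}|$, where $r(\cdot,\cdot)$ denotes the basis relation containing a pair; the indistinguishing number is the maximum of $c(s)$ over the irreflexive basis relations $s$. -}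

module Defs where

open import Level using (0ℓ)
open import Data.Nat using (ℕ; _+_; _∸_; _^_; _≤_)
open import Data.Nat.GCD using (gcd)
open import Data.Fin using (Fin)
open import Data.List using (List; length; map; drop; upTo)
open import Data.Nat.ListAction using (sum)
open import Data.List.Membership.Propositional using (_∈_)
open import Data.List.Relation.Unary.Unique.Propositional using (Unique)
open import Data.Product using (Σ; ∃; _×_; _,_)
open import Relation.Binary.PropositionalEquality using (_≡_; _≢_)
open import Relation.Nullary using (¬_)
open import Function using (_∘_)
open import Function.Bundles using (_⇔_)
open import Algebra.Structures using (IsCommutativeRing)

record IsFieldOn (A : Set) : Set where
  field
    _+F_ _*F_ : A → A → A
    -F_       : A → A
    0F 1F     : A
    isCommRing : IsCommutativeRing _≡_ _+F_ _*F_ -F_ 0F 1F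
    0≢1        : 0F ≢ 1F
    inverse    : ∀ x → x ≢ 0F → Σ A λ y → x *F y ≡ 1F

FieldOfOrder : ℕ → Set
FieldOfOrder q = IsFieldOn (Fin q)

module _ {A : Set} (F : IsFieldOn A) where
  open IsFieldOn F

  record Aut : Set where
    field
      σ     : A → A
      σ⁻¹   : A → A
      left  : ∀ x → σ⁻¹ (σ x) ≡ x
      right : ∀ x → σ (σ⁻¹ x) ≡ x
      pres+ : ∀ x y → σ (x +F y) ≡ σ x +F σ y
      pres* : ∀ x y → σ (x *F y) ≡ σ x *F σ y
      pres1 : σ 1F ≡ 1F

  -- Basis relation s_{x,y} of C(F) on the point set F^× :
  --   s_{x,y} = {(a x^σ, a y^σ) : a ∈ F^×, σ ∈ Aut F}.
  Rel : A → A → A → A → Set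
  Rel x y u v = Σ A λ a → Σ Aut λ τ →
    (a ≢ 0F) × (u ≡ a *F Aut.σ τ x) × (v ≡ a *F Aut.σ τ y)

  Irreflexive : (A → A → Set) → Set
  Irreflexive s = ∀ u → ¬ s u u

  -- r(γ,α) = r(γ,β), where r(u,v) is the basis relation s_{u,v} containing (u,v);
  -- equality of relations = extensional equality as sets of pairs.
  SameRel : A → A → A → Set
  SameRel γ α β = ∀ u v → (Rel γ α u v ⇔ Rel γ β u v)

HasSize : {A : Set} → (A → Set) → ℕ → Set
HasSize {A} P m = Σ (List A) λ xs →
  (length xs ≡ m) × Unique xs × (∀ z → P z ⇔ (z ∈ xs))

bound : ℕ → ℕ → ℕ
bound p d = sum (map (λ i → p ^ gcd i d ∸ 1) (drop 1 (upTo d)))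

-- Let φ be the Frobenius map x ↦ xᵖ.  By pigeonhole among the p^(d+1) polynomials of degree ≤ d with
-- prime-field coefficients, every w is a root of a nonzero one, and so is every conjugate σ w; hence w has
-- at most d conjugates, and β ↦ β / α embeds {β : (α , β) ∈ s_{x,y}} into the conjugates of y / x.
-- The fixed points of φⁱ are roots of x^(pⁱ) − x, so counting them for 0 < i < d yields a z moved by every
-- such φⁱ.  Its d conjugates φⁱ z are distinct, so no nonzero polynomial of degree < d vanishes at z: z
-- generates F, every automorphism is some φⁱ with i < d, φᵈ = id, and s_{1,z} has valency exactly d.
-- Finally r(γ,α) = r(γ,β) forces γ = a φⁱ(γ) and α = a φⁱ(β) with 0 < i < d; for fixed i the ratios of
-- two such γ are fixed by φⁱ and φᵈ, hence by φ^gcd(i,d), leaving at most p^gcd(i,d) − 1 values of γ.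

module Submission where

open import Level using (0ℓ)
open import Algebra.Bundles using (CommutativeRing)
open import Algebra.Properties.CommutativeSemiring.Exp using (^-distrib-*)
import Algebra.Solver.Ring.AlmostCommutativeRing as ACR
open import Algebra.Structures using (IsCommutativeRing)
open import Data.Fin as Fin using (Fin; toℕ)
import Data.Fin.Properties as Finₚ
open import Data.Fin.Permutation using (permutation)
open import Data.Integer as ℤ using (ℤ; -[1+_]; _⊖_; _◃_)
import Data.Integer.Properties as ℤₚ
open import Data.List as List using (List; []; _∷_; length; map; filter; applyDownFrom; drop; upTo)
import Data.List.Properties as Listₚ
open import Data.List.Membership.Propositional using (_∈_; lose)
import Data.List.Membership.Propositional.Properties as Membershipₚ
open import Data.List.Relation.Unary.All as All using (All; []; _∷_)
import Data.List.Relation.Unary.All.Properties as Allₚ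
open import Data.List.Relation.Unary.AllPairs using (_∷_)
open import Data.List.Relation.Unary.Any as Any using (Any; here; there)
open import Data.List.Relation.Unary.Unique.Propositional using (Unique)
import Data.List.Relation.Unary.Unique.Propositional.Properties as Uniqueₚ
open import Data.Maybe using (Maybe; just; nothing)
open import Data.Nat as ℕ using (ℕ; zero; suc; _≤_; _<_; z≤n; s≤s; _!)
open import Data.Nat.Combinatorics using (_C_; nCn≡1; k![n∸k]!∣n!)
open import Data.Nat.Combinatorics.Specification using (nCk≡n!/k![n-k]!)
open import Data.Nat.Coprimality using (coprime-Bézout; prime⇒coprime)
open import Data.Nat.Divisibility using (_∣_; divides; ∣1⇒≡1; ∣⇒≤; m∣m*n)
open import Data.Nat.DivMod using (m/n*n≡m)
open import Data.Nat.GCD using (module Bézout; gcd; gcd-GCD; gcd[m,n]≢0)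
open import Data.Nat.ListAction using (sum)
open import Data.Nat.Primality using (Prime; euclidsLemma; prime⇒nonZero; prime⇒nonTrivial)
import Data.Nat.Properties as ℕₚ
open import Data.Product using (Σ; ∃; _×_; _,_; proj₁; proj₂)
import Data.Sign as Sign
open import Data.Sum using (inj₁; inj₂)
open import Function using (id; _∘_; _|>_)
open import Function.Bundles using (Equivalence; mk⇔; _⇔_)
open import Function.Properties.Equivalence using () renaming (trans to ⇔-trans)
open import Function.Definitions using (Injective)
open import Relation.Binary.Definitions using (DecidableEquality; tri<; tri≈; tri>)
open import Relation.Binary.PropositionalEquality
open import Relation.Nullary using (¬_; Dec; yes; no; ¬?; _×-dec_; contradiction)
open import Relation.Nullary.Decidable using (decidable-stable)
open import Relation.Unary using (Decidable)
open import Relation.Unary.Properties using (∁?)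
open import Defs

module _ {A : Set} where

  length-filter+length-filter-∁ : ∀ {P : A → Set} (P? : Decidable P) xs →
    length (filter P? xs) ℕ.+ length (filter (∁? P?) xs) ≡ length xs
  length-filter+length-filter-∁ P? [] = refl
  length-filter+length-filter-∁ P? (x ∷ xs) with P? x
  ... | yes _ = cong suc (length-filter+length-filter-∁ P? xs)
  ... | no _ = trans (ℕₚ.+-suc _ _) (cong suc (length-filter+length-filter-∁ P? xs))

  union-bound : (P : ℕ → A → Set) (P? : ∀ i → Decidable (P i)) (bound : ℕ → ℕ) (is : List ℕ) →
    (∀ {i} → i ∈ is → ∀ {ys} → Unique ys → All (P i) ys → length ys ≤ bound i) →
    ∀ {xs} → Unique xs → All (λ x → Any (λ i → P i x) is) xs → length xs ≤ sum (map bound is)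
  union-bound P P? bound [] _ {[]} _ _ = z≤n
  union-bound P P? bound [] _ {x ∷ xs} _ (() ∷ _)
  union-bound P P? bound (i ∷ is) bounded {xs} unique covered =
    subst (_≤ sum (map bound (i ∷ is))) (length-filter+length-filter-∁ (P? i) xs)
      (ℕₚ.+-mono-≤ (bounded (here refl) (Uniqueₚ.filter⁺ (P? i) unique) (Allₚ.all-filter (P? i) xs))
        (union-bound P P? bound is (bounded ∘ there) (Uniqueₚ.filter⁺ (∁? (P? i)) unique)
          (All.zipWith (λ (c , ¬p) → Any.tail ¬p c)
            (Allₚ.filter⁺ (∁? (P? i)) covered , Allₚ.all-filter (∁? (P? i)) xs))))

  hasSize-bound : ∀ {P : A → Set} {m b} → (∀ {xs} → Unique xs → All P xs → length xs ≤ b) →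
                  HasSize P m → m ≤ b
  hasSize-bound bounded (xs , length≡m , unique , ∈⇔) =
    subst (_≤ _) length≡m (bounded unique (All.tabulate (Equivalence.from (∈⇔ _))))

injective⇒surjective : ∀ {n} (f : Fin n → Fin n) → Injective _≡_ _≡_ f → ∀ y → ∃ λ x → f x ≡ y
injective⇒surjective {n} f f-inj y with Finₚ.any? (λ x → f x Fin.≟ y)
... | yes hit = hit
... | no miss = contradiction (Finₚ.injective⇒≤ g-inj) ℕₚ.1+n≰n
  where
  g : Fin (suc n) → Fin n
  g Fin.zero = y
  g (Fin.suc x) = f x
  g-inj : Injective _≡_ _≡_ g
  g-inj {Fin.zero} {Fin.zero} _ = refl
  g-inj {Fin.zero} {Fin.suc x} e = contradiction (x , sym e) miss
  g-inj {Fin.suc x} {Fin.zero} e = contradiction (x , e) miss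
  g-inj {Fin.suc x} {Fin.suc x′} e = cong Fin.suc (f-inj e)

digits : ∀ {b} k → Fin (b ℕ.^ k) → List (Fin b)
digits zero _ = []
digits {b} (suc k) i = proj₁ (Fin.remQuot {b} (b ℕ.^ k) i) ∷ digits k (proj₂ (Fin.remQuot {b} (b ℕ.^ k) i))

length-digits : ∀ {b} k i → length (digits {b} k i) ≡ k
length-digits zero i = refl
length-digits (suc k) i = cong suc (length-digits k _)

digits-injective : ∀ {b} k {i j} → digits {b} k i ≡ digits k j → i ≡ j
digits-injective zero {Fin.zero} {Fin.zero} _ = refl
digits-injective {b} (suc k) {i} {j} eq = begin
  i                                          ≡⟨ sym (Finₚ.combine-remQuot {b} (b ℕ.^ k) i) ⟩
  Fin.combine (proj₁ (rq i)) (proj₂ (rq i))  ≡⟨ cong₂ Fin.combine (Listₚ.∷-injectiveˡ eq)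
                                                  (digits-injective k (Listₚ.∷-injectiveʳ eq)) ⟩
  Fin.combine (proj₁ (rq j)) (proj₂ (rq j))  ≡⟨ Finₚ.combine-remQuot {b} (b ℕ.^ k) j ⟩
  j                                          ∎
  where
  open ≡-Reasoning
  rq = Fin.remQuot {b} (b ℕ.^ k)

prime∤m! : ∀ {p} → Prime p → ∀ {m} → m < p → ¬ p ∣ m !
prime∤m! p-prime {zero} _ p∣1 with refl ← ∣1⇒≡1 p∣1 = contradiction (prime⇒nonTrivial p-prime) λ ()
prime∤m! p-prime {suc m} m<p p∣m! with euclidsLemma (suc m) (m !) p-prime p∣m!
... | inj₁ p∣1+m = ℕₚ.<⇒≱ m<p (∣⇒≤ p∣1+m)
... | inj₂ p∣m! = prime∤m! p-prime (ℕₚ.<-trans (ℕₚ.n<1+n m) m<p) p∣m!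

prime∣pCk : ∀ {p} → Prime p → ∀ {k} → 0 < k → k < p → p ∣ p C k
prime∣pCk {p@(suc p′)} p-prime {k} 0<k k<p
  with euclidsLemma (p C k) (k ! ℕ.* (p ℕ.∸ k) !) p-prime p∣pCk*k![p-k]!
  where
  instance _ = ℕₚ._!*_!≢0 k (p ℕ.∸ k)
  p∣pCk*k![p-k]! : p ∣ (p C k) ℕ.* (k ! ℕ.* (p ℕ.∸ k) !)
  p∣pCk*k![p-k]! = subst (λ t → p ∣ t ℕ.* (k ! ℕ.* (p ℕ.∸ k) !)) (sym (nCk≡n!/k![n-k]! (ℕₚ.<⇒≤ k<p)))
    (subst (p ∣_) (sym (m/n*n≡m (k![n∸k]!∣n! (ℕₚ.<⇒≤ k<p)))) (m∣m*n (p′ !)))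
... | inj₁ p∣pCk = p∣pCk
... | inj₂ p∣k!*[p-k]! with euclidsLemma (k !) ((p ℕ.∸ k) !) p-prime p∣k!*[p-k]!
...   | inj₁ p∣k! = contradiction p∣k! (prime∤m! p-prime k<p)
...   | inj₂ p∣[p-k]! = contradiction p∣[p-k]! (prime∤m! p-prime (ℕₚ.∸-monoʳ-< 0<k (ℕₚ.<⇒≤ k<p)))

∈-applyDownFrom-suc⁻ : ∀ n {i} → i ∈ applyDownFrom suc n → 1 ≤ i × i ≤ n
∈-applyDownFrom-suc⁻ (suc n) (here refl) = s≤s z≤n , ℕₚ.≤-refl
∈-applyDownFrom-suc⁻ (suc n) (there i∈) with 1≤i , i≤n ← ∈-applyDownFrom-suc⁻ n i∈ = 1≤i , ℕₚ.m≤n⇒m≤1+n i≤n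

∈-applyDownFrom-suc⁺ : ∀ n {i} → 1 ≤ i → i ≤ n → i ∈ applyDownFrom suc n
∈-applyDownFrom-suc⁺ zero (s≤s _) ()
∈-applyDownFrom-suc⁺ (suc n) {i} 1≤i i≤1+n with i ℕ.≟ suc n
... | yes refl = here refl
... | no i≢1+n = there (∈-applyDownFrom-suc⁺ n 1≤i (ℕₚ.≤-pred (ℕₚ.≤∧≢⇒< i≤1+n i≢1+n)))

geometric-sum-bound : ∀ {p} → 2 ≤ p → ∀ n → sum (map (p ℕ.^_) (applyDownFrom suc n)) ℕ.+ p ≤ p ℕ.^ suc n
geometric-sum-bound {p} 2≤p zero = ℕₚ.≤-reflexive (sym (ℕₚ.*-identityʳ p))
geometric-sum-bound {p} 2≤p (suc n) = begin
  (p ℕ.^ suc n ℕ.+ s) ℕ.+ p      ≡⟨ ℕₚ.+-assoc (p ℕ.^ suc n) s p ⟩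
  p ℕ.^ suc n ℕ.+ (s ℕ.+ p)      ≤⟨ ℕₚ.+-monoʳ-≤ (p ℕ.^ suc n) (geometric-sum-bound 2≤p n) ⟩
  p ℕ.^ suc n ℕ.+ p ℕ.^ suc n    ≡⟨ cong (p ℕ.^ suc n ℕ.+_) (sym (ℕₚ.+-identityʳ _)) ⟩
  2 ℕ.* p ℕ.^ suc n              ≤⟨ ℕₚ.*-monoˡ-≤ (p ℕ.^ suc n) 2≤p ⟩
  p ℕ.^ suc (suc n)              ∎
  where
  open ℕₚ.≤-Reasoning
  s = sum (map (p ℕ.^_) (applyDownFrom suc n))

sum-p^i<p^n : ∀ {p} → 2 ≤ p → ∀ {n} → 0 < n → sum (map (p ℕ.^_) (applyDownFrom suc (ℕ.pred n))) < p ℕ.^ n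
sum-p^i<p^n {p} 2≤p {suc n} _ =
  ℕₚ.<-≤-trans (ℕₚ.m<m+n _ (ℕₚ.<-trans (s≤s z≤n) 2≤p)) (geometric-sum-bound 2≤p n)

∈-drop-1-upTo : ∀ {n i} → 0 < i → i < n → i ∈ drop 1 (upTo n)
∈-drop-1-upTo {suc n} {suc i} _ (s≤s i<n) = Membershipₚ.∈-applyUpTo⁺ suc i<n

∈-drop-1-upTo⁻ : ∀ {n i} → i ∈ drop 1 (upTo n) → 0 < i × i < n
∈-drop-1-upTo⁻ {suc n} i∈ with j , j<n , refl ← Membershipₚ.∈-applyUpTo⁻ suc i∈ = s≤s z≤n , s≤s j<n

module RingSolver {A : Set} {add mul : A → A → A} {neg : A → A} {0ᴬ 1ᴬ : A}
  (isCommutativeRing : IsCommutativeRing _≡_ add mul neg 0ᴬ 1ᴬ) where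

  ring : CommutativeRing 0ℓ 0ℓ
  ring = record { isCommutativeRing = isCommutativeRing }

  open CommutativeRing ring
    using (_+_; _*_; -_; 0#; 1#; +-comm; +-assoc; +-identityˡ; +-identityʳ; -‿inverseʳ; semiring)
    renaming (ring to ringᵒ)
  open import Algebra.Properties.Ring ringᵒ
    using (-0#≈0#; -‿involutive; -‿distribˡ-*; -‿distribʳ-*; -‿+-comm)
  open import Algebra.Properties.Semiring.Mult semiring using (×-homo-+; ×1-homo-*) renaming (_×_ to _·_)
  open ≡-Reasoning

  -- The ring solver needs a coefficient ring with decidable equality; ℤ maps into any ring.
  fromℤ : ℤ → A
  fromℤ (ℤ.+ n) = n · 1#
  fromℤ -[1+ n ] = - (suc n · 1#)

  fromℤ-neg : ∀ i → fromℤ (ℤ.- i) ≡ - fromℤ i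
  fromℤ-neg -[1+ n ] = sym (-‿involutive _)
  fromℤ-neg (ℤ.+ zero) = sym -0#≈0#
  fromℤ-neg (ℤ.+ suc n) = refl

  fromℤ-⊖ : ∀ m n → fromℤ (m ⊖ n) ≡ m · 1# + - (n · 1#)
  fromℤ-⊖ m zero = sym (trans (cong (m · 1# +_) -0#≈0#) (+-identityʳ _))
  fromℤ-⊖ zero (suc n) = sym (+-identityˡ _)
  fromℤ-⊖ (suc m) (suc n) = begin
    fromℤ (suc m ⊖ suc n)            ≡⟨ cong fromℤ (ℤₚ.[1+m]⊖[1+n]≡m⊖n m n) ⟩
    fromℤ (m ⊖ n)                    ≡⟨ fromℤ-⊖ m n ⟩
    m · 1# + - (n · 1#)              ≡⟨ shift (m · 1#) (n · 1#) ⟩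
    suc m · 1# + - (suc n · 1#)      ∎
    where
    shift : ∀ a b → a + - b ≡ (1# + a) + - (1# + b)
    shift a b = begin
      a + - b                        ≡⟨ sym (+-identityˡ _) ⟩
      0# + (a + - b)                 ≡⟨ cong (_+ (a + - b)) (sym (-‿inverseʳ 1#)) ⟩
      (1# + - 1#) + (a + - b)        ≡⟨ +-assoc 1# _ _ ⟩
      1# + (- 1# + (a + - b))        ≡⟨ cong (1# +_) (sym (+-assoc _ a _)) ⟩
      1# + ((- 1# + a) + - b)        ≡⟨ cong (λ t → 1# + (t + - b)) (+-comm _ a) ⟩
      1# + ((a + - 1#) + - b)        ≡⟨ cong (1# +_) (+-assoc a _ _) ⟩
      1# + (a + (- 1# + - b))        ≡⟨ sym (+-assoc 1# a _) ⟩
      (1# + a) + (- 1# + - b)        ≡⟨ cong ((1# + a) +_) (-‿+-comm 1# b) ⟩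
      (1# + a) + - (1# + b)          ∎

  fromℤ-+ : ∀ i j → fromℤ (i ℤ.+ j) ≡ fromℤ i + fromℤ j
  fromℤ-+ -[1+ m ] -[1+ n ] = begin
    - (suc (suc (m ℕ.+ n)) · 1#)     ≡⟨ cong (λ k → - (k · 1#)) (sym (ℕₚ.+-suc (suc m) n)) ⟩
    - ((suc m ℕ.+ suc n) · 1#)       ≡⟨ cong -_ (×-homo-+ 1# (suc m) (suc n)) ⟩
    - (suc m · 1# + suc n · 1#)      ≡⟨ sym (-‿+-comm _ _) ⟩
    - (suc m · 1#) + - (suc n · 1#)  ∎
  fromℤ-+ -[1+ m ] (ℤ.+ n) = trans (fromℤ-⊖ n (suc m)) (+-comm _ _)
  fromℤ-+ (ℤ.+ m) -[1+ n ] = fromℤ-⊖ m (suc n)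
  fromℤ-+ (ℤ.+ m) (ℤ.+ n) = ×-homo-+ 1# m n

  fromℤ-* : ∀ i j → fromℤ (i ℤ.* j) ≡ fromℤ i * fromℤ j
  fromℤ-* (ℤ.+ m) (ℤ.+ n) = trans (cong fromℤ (ℤₚ.+◃n≡+n (m ℕ.* n))) (×1-homo-* m n)
  fromℤ-* (ℤ.+ m) -[1+ n ] = begin
    fromℤ (Sign.- ◃ (m ℕ.* suc n))   ≡⟨ cong fromℤ (ℤₚ.-◃n≡-n (m ℕ.* suc n)) ⟩
    fromℤ (ℤ.- (ℤ.+ (m ℕ.* suc n)))  ≡⟨ fromℤ-neg (ℤ.+ (m ℕ.* suc n)) ⟩
    - ((m ℕ.* suc n) · 1#)           ≡⟨ cong -_ (×1-homo-* m (suc n)) ⟩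
    - ((m · 1#) * (suc n · 1#))      ≡⟨ -‿distribʳ-* _ _ ⟩
    (m · 1#) * - (suc n · 1#)        ∎
  fromℤ-* -[1+ m ] (ℤ.+ n) = begin
    fromℤ (Sign.- ◃ (suc m ℕ.* n))   ≡⟨ cong fromℤ (ℤₚ.-◃n≡-n (suc m ℕ.* n)) ⟩
    fromℤ (ℤ.- (ℤ.+ (suc m ℕ.* n)))  ≡⟨ fromℤ-neg (ℤ.+ (suc m ℕ.* n)) ⟩
    - ((suc m ℕ.* n) · 1#)           ≡⟨ cong -_ (×1-homo-* (suc m) n) ⟩
    - ((suc m · 1#) * (n · 1#))      ≡⟨ -‿distribˡ-* _ _ ⟩
    - (suc m · 1#) * (n · 1#)        ∎
  fromℤ-* -[1+ m ] -[1+ n ] = begin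
    (suc m ℕ.* suc n) · 1#                 ≡⟨ ×1-homo-* (suc m) (suc n) ⟩
    (suc m · 1#) * (suc n · 1#)            ≡⟨ sym (-‿involutive _) ⟩
    - - ((suc m · 1#) * (suc n · 1#))      ≡⟨ cong -_ (-‿distribˡ-* _ _) ⟩
    - ((- (suc m · 1#)) * (suc n · 1#))    ≡⟨ -‿distribʳ-* _ _ ⟩
    - (suc m · 1#) * - (suc n · 1#)        ∎

  fromℤ-morphism : CommutativeRing.rawRing ℤₚ.+-*-commutativeRing
                     ACR.-Raw-AlmostCommutative⟶ ACR.fromCommutativeRing ring
  fromℤ-morphism = record
    { ⟦_⟧ = fromℤ ; +-homo = fromℤ-+ ; *-homo = fromℤ-* ; -‿homo = fromℤ-neg
    ; 0-homo = refl ; 1-homo = +-identityʳ 1# }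

  fromℤ-≟ : ∀ i j → Maybe (fromℤ i ≡ fromℤ j)
  fromℤ-≟ i j with i ℤ.≟ j
  ... | yes refl = just refl
  ... | no _ = nothing

  open import Algebra.Solver.Ring (CommutativeRing.rawRing ℤₚ.+-*-commutativeRing)
    (ACR.fromCommutativeRing ring) fromℤ-morphism fromℤ-≟ public
    using (solve; _:=_; _:+_; _:*_; :-_; _:-_; con)

module FieldProperties {A : Set} (F : IsFieldOn A) (_≟_ : DecidableEquality A) where

  open IsFieldOn F using (inverse; 0≢1; isCommRing)
  open RingSolver isCommRing public using (ring; solve; _:=_; _:+_; _:*_; :-_; _:-_; con)

  open CommutativeRing ring public
    using (_+_; _*_; -_; 0#; 1#; +-comm; +-assoc; +-identityˡ; +-identityʳ; -‿inverseʳ;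
           *-comm; *-assoc; *-identityˡ; *-identityʳ; zeroˡ; zeroʳ)
  open CommutativeRing ring using (semiring) renaming (ring to ringᵒ)
  open import Algebra.Properties.Ring ringᵒ public
    using (-0#≈0#; +-inverseʳ-unique; +-identityʳ-unique; x∙y⁻¹≈ε⇒x≈y; x≈y⇒x∙y⁻¹≈ε)
  open import Algebra.Properties.Semiring.Exp semiring public using (_^_)
  open import Algebra.Properties.Semiring.Mult semiring public
    using (×-homo-+; ×1-homo-*; ×-assoc-*) renaming (_×_ to _·_)
  open ≡-Reasoning

  1≢0 : 1# ≢ 0#
  1≢0 1≡0 = 0≢1 (sym 1≡0)

  inv : (x : A) → x ≢ 0# → A
  inv x x≢0 = proj₁ (inverse x x≢0)

  inv-inverseʳ : ∀ x (x≢0 : x ≢ 0#) → x * inv x x≢0 ≡ 1#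
  inv-inverseʳ x x≢0 = proj₂ (inverse x x≢0)

  inv-inverseˡ : ∀ x (x≢0 : x ≢ 0#) → inv x x≢0 * x ≡ 1#
  inv-inverseˡ x x≢0 = trans (*-comm _ x) (inv-inverseʳ x x≢0)

  *-cancelˡ : ∀ {a x y} → a ≢ 0# → a * x ≡ a * y → x ≡ y
  *-cancelˡ {a} {x} {y} a≢0 eq = begin
    x                      ≡⟨ sym (*-identityˡ x) ⟩
    1# * x                 ≡⟨ cong (_* x) (sym (inv-inverseˡ a a≢0)) ⟩
    (inv a a≢0 * a) * x    ≡⟨ *-assoc _ a x ⟩
    inv a a≢0 * (a * x)    ≡⟨ cong (inv a a≢0 *_) eq ⟩
    inv a a≢0 * (a * y)    ≡⟨ sym (*-assoc _ a y) ⟩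
    (inv a a≢0 * a) * y    ≡⟨ cong (_* y) (inv-inverseˡ a a≢0) ⟩
    1# * y                 ≡⟨ *-identityˡ y ⟩
    y                      ∎

  *-cancelʳ : ∀ {a x y} → a ≢ 0# → x * a ≡ y * a → x ≡ y
  *-cancelʳ {a} {x} {y} a≢0 eq = *-cancelˡ a≢0 (trans (*-comm a x) (trans eq (*-comm y a)))

  a*x≡0⇒x≡0 : ∀ {a x} → a ≢ 0# → a * x ≡ 0# → x ≡ 0#
  a*x≡0⇒x≡0 a≢0 eq = *-cancelˡ a≢0 (trans eq (sym (zeroʳ _)))

  *-≢0 : ∀ {a b} → a ≢ 0# → b ≢ 0# → a * b ≢ 0#
  *-≢0 a≢0 b≢0 eq = b≢0 (a*x≡0⇒x≡0 a≢0 eq)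

  inv-≢0 : ∀ x (x≢0 : x ≢ 0#) → inv x x≢0 ≢ 0#
  inv-≢0 x x≢0 eq = 0≢1 (begin
    0#               ≡⟨ sym (zeroʳ x) ⟩
    x * 0#           ≡⟨ cong (x *_) (sym eq) ⟩
    x * inv x x≢0    ≡⟨ inv-inverseʳ x x≢0 ⟩
    1#               ∎)

  ·1-^ : ∀ n k → (n · 1#) ^ k ≡ (n ℕ.^ k) · 1#
  ·1-^ n zero = sym (+-identityʳ 1#)
  ·1-^ n (suc k) = trans (cong ((n · 1#) *_) (·1-^ n k)) (sym (×1-homo-* n (n ℕ.^ k)))

  x^k≡0⇒x≡0 : ∀ {x} k → x ^ k ≡ 0# → x ≡ 0#
  x^k≡0⇒x≡0 zero 1≡0 = contradiction (sym 1≡0) 0≢1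
  x^k≡0⇒x≡0 {x} (suc k) x^[1+k]≡0 with x ≟ 0#
  ... | yes x≡0 = x≡0
  ... | no x≢0 = x^k≡0⇒x≡0 k (a*x≡0⇒x≡0 x≢0 x^[1+k]≡0)

  1^n≡1 : ∀ n → 1# ^ n ≡ 1#
  1^n≡1 zero = refl
  1^n≡1 (suc n) = trans (cong (1# *_) (1^n≡1 n)) (*-identityˡ 1#)

  n·1≡0⇒n·x≡0 : ∀ {n} → n · 1# ≡ 0# → ∀ x → n · x ≡ 0#
  n·1≡0⇒n·x≡0 {n} n·1≡0 x = begin
    n · x          ≡⟨ cong (n ·_) (sym (*-identityˡ x)) ⟩
    n · (1# * x)   ≡⟨ sym (×-assoc-* n 1# x) ⟩
    (n · 1#) * x   ≡⟨ cong (_* x) n·1≡0 ⟩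
    0# * x         ≡⟨ zeroˡ x ⟩
    0#             ∎

  m*n·1≡0 : ∀ m {n} → n · 1# ≡ 0# → (m ℕ.* n) · 1# ≡ 0#
  m*n·1≡0 m n·1≡0 = trans (×1-homo-* m _) (trans (cong (m · 1# *_) n·1≡0) (zeroʳ _))

  1+a≡b∧a·1≡0⇒b·1≢0 : ∀ {a b} → 1 ℕ.+ a ≡ b → a · 1# ≡ 0# → b · 1# ≢ 0#
  1+a≡b∧a·1≡0⇒b·1≢0 {a} refl a·1≡0 b·1≡0 = 1≢0 (begin
    1#             ≡⟨ +-identityʳ 1# ⟨
    1# + 0#        ≡⟨ cong (1# +_) a·1≡0 ⟨
    1# + a · 1#    ≡⟨ b·1≡0 ⟩
    0#             ∎)

  record IsRingEndomorphism (h : A → A) : Set where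
    field
      +-homo : ∀ x y → h (x + y) ≡ h x + h y
      *-homo : ∀ x y → h (x * y) ≡ h x * h y
      1-homo : h 1# ≡ 1#

    0-homo : h 0# ≡ 0#
    0-homo = +-identityʳ-unique (h 0#) (h 0#) (trans (sym (+-homo 0# 0#)) (cong h (+-identityʳ 0#)))

    -‿homo : ∀ x → h (- x) ≡ - h x
    -‿homo x = +-inverseʳ-unique (h x) (h (- x))
      (trans (sym (+-homo x (- x))) (trans (cong h (-‿inverseʳ x)) 0-homo))

    ·1-homo : ∀ n → h (n · 1#) ≡ n · 1#
    ·1-homo zero = 0-homo
    ·1-homo (suc n) = trans (+-homo 1# (n · 1#)) (cong₂ _+_ 1-homo (·1-homo n))

    ≢0-homo : ∀ {x} → x ≢ 0# → h x ≢ 0#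
    ≢0-homo {x} x≢0 hx≡0 = 0≢1 (begin
      0#                    ≡⟨ sym (zeroˡ _) ⟩
      0# * h (inv x x≢0)    ≡⟨ cong (_* h (inv x x≢0)) (sym hx≡0) ⟩
      h x * h (inv x x≢0)   ≡⟨ sym (*-homo x _) ⟩
      h (x * inv x x≢0)     ≡⟨ cong h (inv-inverseʳ x x≢0) ⟩
      h 1#                  ≡⟨ 1-homo ⟩
      1#                    ∎)

    injective : Injective _≡_ _≡_ h
    injective {x} {y} hx≡hy =
      x∙y⁻¹≈ε⇒x≈y x y (decidable-stable ((x + - y) ≟ 0#) λ x-y≢0 → ≢0-homo x-y≢0 (begin
        h (x + - y)    ≡⟨ +-homo x (- y) ⟩
        h x + h (- y)  ≡⟨ cong (h x +_) (-‿homo y) ⟩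
        h x + - h y    ≡⟨ x≈y⇒x∙y⁻¹≈ε hx≡hy ⟩
        0#             ∎))

  id-isRingEndomorphism : IsRingEndomorphism (λ x → x)
  id-isRingEndomorphism = record { +-homo = λ _ _ → refl ; *-homo = λ _ _ → refl ; 1-homo = refl }

  ∘-isRingEndomorphism : ∀ {g h} → IsRingEndomorphism g → IsRingEndomorphism h →
                         IsRingEndomorphism (λ x → g (h x))
  ∘-isRingEndomorphism {g} {h} G H = record
    { +-homo = λ x y → trans (cong g (IsRingEndomorphism.+-homo H x y)) (IsRingEndomorphism.+-homo G _ _)
    ; *-homo = λ x y → trans (cong g (IsRingEndomorphism.*-homo H x y)) (IsRingEndomorphism.*-homo G _ _)
    ; 1-homo = trans (cong g (IsRingEndomorphism.1-homo H)) (IsRingEndomorphism.1-homo G) }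

  σ-isRingEndomorphism : (τ : Aut F) → IsRingEndomorphism (Aut.σ τ)
  σ-isRingEndomorphism τ = record { +-homo = Aut.pres+ τ ; *-homo = Aut.pres* τ ; 1-homo = Aut.pres1 τ }

  σ-≢0 : (τ : Aut F) → ∀ {x} → x ≢ 0# → Aut.σ τ x ≢ 0#
  σ-≢0 τ = IsRingEndomorphism.≢0-homo (σ-isRingEndomorphism τ)

  -- f is a polynomial function of formal degree n whose coefficient of xⁿ is a.
  IsPolynomial : ℕ → A → (A → A) → Set
  IsPolynomial zero a f = ∀ x → f x ≡ a
  IsPolynomial (suc n) a f = Σ (A → A) λ g → Σ A λ c → IsPolynomial n a g × (∀ x → f x ≡ c + x * g x)

  +-isPolynomial : ∀ {n a b f g} → IsPolynomial n a f → IsPolynomial n b g →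
                   IsPolynomial n (a + b) (λ x → f x + g x)
  +-isPolynomial {zero} f≡a g≡b x = cong₂ _+_ (f≡a x) (g≡b x)
  +-isPolynomial {suc n} (f′ , c , f′-poly , f≡) (g′ , d , g′-poly , g≡) =
    (λ x → f′ x + g′ x) , c + d , +-isPolynomial f′-poly g′-poly , λ x →
      trans (cong₂ _+_ (f≡ x) (g≡ x))
        (solve 5 (λ c x u d v → (c :+ x :* u) :+ (d :+ x :* v) := (c :+ d) :+ x :* (u :+ v))
          refl c x (f′ x) d (g′ x))

  *-isPolynomial : ∀ {n a f} s → IsPolynomial n a f → IsPolynomial n (s * a) (λ x → s * f x)
  *-isPolynomial {zero} s f≡a x = cong (s *_) (f≡a x)
  *-isPolynomial {suc n} s (f′ , c , f′-poly , f≡) =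
    (λ x → s * f′ x) , s * c , *-isPolynomial s f′-poly , λ x →
      trans (cong (s *_) (f≡ x))
        (solve 4 (λ s c x u → s :* (c :+ x :* u) := s :* c :+ x :* (s :* u)) refl s c x (f′ x))

  isPolynomial-suc : ∀ {n b f} → IsPolynomial n b f → IsPolynomial (suc n) 0# f
  isPolynomial-suc {zero} {b} f≡b = (λ _ → 0#) , b , (λ _ → refl) , λ x →
    trans (f≡b x) (sym (trans (cong (b +_) (zeroʳ x)) (+-identityʳ b)))
  isPolynomial-suc {suc n} (f′ , c , f′-poly , f≡) = f′ , c , isPolynomial-suc f′-poly , f≡

  ^-isPolynomial : ∀ n → IsPolynomial n 1# (_^ n)
  ^-isPolynomial zero x = refl
  ^-isPolynomial (suc n) = (_^ n) , 0# , ^-isPolynomial n , λ x → sym (+-identityˡ _)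

  x^q-x-isPolynomial : ∀ m → IsPolynomial (suc (suc m)) 1# (λ x → x ^ suc (suc m) + - x)
  x^q-x-isPolynomial m =
    (λ x → x ^ suc m + - 1#) , 0# ,
    ((_^ m) , - 1# , ^-isPolynomial m , λ x → +-comm _ _) ,
    λ x → begin
      x * (x * x ^ m) + - x               ≡⟨ cong (λ v → x * (x * x ^ m) + - v) (sym (*-identityʳ x)) ⟩
      x * (x * x ^ m) + - (x * 1#)        ≡⟨ solve 3 (λ x y o → x :* (x :* y) :- x :* o
                                               := con (ℤ.+ 0) :+ x :* (x :* y :- o)) refl x (x ^ m) 1# ⟩
      0# + x * (x * x ^ m + - 1#)         ∎

  factor-theorem : ∀ {n a f} r → IsPolynomial (suc n) a f → f r ≡ 0# →
                   ∃ λ g → IsPolynomial n a g × (∀ x → f x ≡ (x + - r) * g x)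
  factor-theorem {zero} {a} {f} r (g , c , g≡a , f≡) fr≡0 = (λ _ → a) , (λ _ → refl) , λ x → begin
    f x                 ≡⟨ f≡ x ⟩
    c + x * g x         ≡⟨ cong₂ (λ u v → u + x * v) c≡-ra (g≡a x) ⟩
    - (r * a) + x * a   ≡⟨ solve 3 (λ r a x → (:- (r :* a)) :+ x :* a := (x :- r) :* a) refl r a x ⟩
    (x + - r) * a       ∎
    where
    c≡-ra : c ≡ - (r * a)
    c≡-ra = +-inverseʳ-unique _ c (trans (+-comm _ c)
      (trans (cong (λ v → c + r * v) (sym (g≡a r))) (trans (sym (f≡ r)) fr≡0)))
  factor-theorem {suc n} {a} {f} r (g , c , g-poly@(g′ , c′ , g′-poly , g≡) , f≡) fr≡0 =
    (λ x → g x + r * k x) ,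
    subst (λ b → IsPolynomial (suc n) b (λ x → g x + r * k x)) (+-identityʳ a)
      (+-isPolynomial g-poly (isPolynomial-suc (*-isPolynomial r k-poly))) ,
    λ x → begin
      f x
        ≡⟨ f≡ x ⟩
      c + x * g x
        ≡⟨ cong (_+ x * g x) c≡-rgr ⟩
      - (r * g r) + x * g x
        ≡⟨ solve 4 (λ r G x u → (:- (r :* G)) :+ x :* u := (x :- r) :* u :+ r :* (u :- G))
             refl r (g r) x (g x) ⟩
      (x + - r) * g x + r * (g x + - g r)
        ≡⟨ cong (λ v → (x + - r) * g x + r * v) (g-gr≡ x) ⟩
      (x + - r) * g x + r * ((x + - r) * k x)
        ≡⟨ solve 4 (λ x r u k → (x :- r) :* u :+ r :* ((x :- r) :* k) := (x :- r) :* (u :+ r :* k))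
             refl x r (g x) (k x) ⟩
      (x + - r) * (g x + r * k x) ∎
    where
    c≡-rgr : c ≡ - (r * g r)
    c≡-rgr = +-inverseʳ-unique _ c (trans (+-comm _ c) (trans (sym (f≡ r)) fr≡0))
    g-gr-poly : IsPolynomial (suc n) a (λ x → g x + - g r)
    g-gr-poly = g′ , c′ + - g r , g′-poly , λ x → trans (cong (_+ - g r) (g≡ x))
      (solve 4 (λ c x u G → (c :+ x :* u) :- G := (c :- G) :+ x :* u) refl c′ x (g′ x) (g r))
    quotient = factor-theorem r g-gr-poly (-‿inverseʳ (g r))
    k = proj₁ quotient
    k-poly = proj₁ (proj₂ quotient)
    g-gr≡ = proj₂ (proj₂ quotient)

  root-bound : ∀ {n a f} → a ≢ 0# → IsPolynomial n a f →
               ∀ {rs} → Unique rs → All (λ r → f r ≡ 0#) rs → length rs ≤ n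
  root-bound a≢0 f-poly {[]} _ _ = z≤n
  root-bound {zero} a≢0 f≡a {r ∷ _} _ (fr≡0 ∷ _) = contradiction (trans (sym (f≡a r)) fr≡0) a≢0
  root-bound {suc n} {a} {f} a≢0 f-poly {r ∷ rs} (r∉rs ∷ unique) (fr≡0 ∷ roots)
    with g , g-poly , f≡ ← factor-theorem r f-poly fr≡0 =
    s≤s (root-bound a≢0 g-poly unique (All.zipWith root-of-quotient (r∉rs , roots)))
    where
    root-of-quotient : ∀ {t} → r ≢ t × f t ≡ 0# → g t ≡ 0#
    root-of-quotient {t} (r≢t , ft≡0) =
      a*x≡0⇒x≡0 (λ t-r≡0 → r≢t (sym (x∙y⁻¹≈ε⇒x≈y t r t-r≡0))) (trans (sym (f≡ t)) ft≡0)

  x^q≡x-root-bound : ∀ {q} → 2 ≤ q → ∀ {rs} → Unique rs → All (λ r → r ^ q ≡ r) rs → length rs ≤ q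
  x^q≡x-root-bound {suc zero} (s≤s ()) _ _
  x^q≡x-root-bound {suc (suc m)} _ unique roots =
    root-bound 1≢0 (x^q-x-isPolynomial m) unique (All.map x≈y⇒x∙y⁻¹≈ε roots)

  eval : List A → A → A
  eval [] x = 0#
  eval (c ∷ cs) x = c + x * eval cs x

  eval-zeros : ∀ {cs} → All (_≡ 0#) cs → ∀ x → eval cs x ≡ 0#
  eval-zeros [] x = refl
  eval-zeros {_ ∷ cs} (refl ∷ zeros) x = begin
    0# + x * eval cs x  ≡⟨ cong (λ v → 0# + x * v) (eval-zeros zeros x) ⟩
    0# + x * 0#         ≡⟨ +-identityˡ _ ⟩
    x * 0#              ≡⟨ zeroʳ x ⟩
    0#                  ∎

  eval-isPolynomial : ∀ cs → Any (_≢ 0#) cs →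
                      ∃ λ n → ∃ λ a → a ≢ 0# × n < length cs × IsPolynomial n a (eval cs)
  eval-isPolynomial (c ∷ cs) nonzero with Any.any? (λ c → ¬? (c ≟ 0#)) cs
  ... | yes cs-nonzero with n , a , a≢0 , n<len , poly ← eval-isPolynomial cs cs-nonzero =
    suc n , a , a≢0 , s≤s n<len , eval cs , c , poly , λ _ → refl
  ... | no cs-zero = 0 , c , c≢0 nonzero , s≤s z≤n , λ x → begin
    c + x * eval cs x   ≡⟨ cong (λ v → c + x * v) (eval-zeros zeros x) ⟩
    c + x * 0#          ≡⟨ cong (c +_) (zeroʳ x) ⟩
    c + 0#              ≡⟨ +-identityʳ c ⟩
    c                   ∎
    where
    zeros : All (_≡ 0#) cs
    zeros = All.map (decidable-stable (_ ≟ 0#)) (Allₚ.¬Any⇒All¬ cs cs-zero)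
    c≢0 : Any (_≢ 0#) (c ∷ cs) → c ≢ 0#
    c≢0 (here c≢0) = c≢0
    c≢0 (there cs-nonzero) = contradiction cs-nonzero cs-zero

  eval-root-bound : ∀ {cs} → Any (_≢ 0#) cs →
                    ∀ {rs} → Unique rs → All (λ r → eval cs r ≡ 0#) rs → length rs < length cs
  eval-root-bound {cs} nonzero unique roots with n , a , a≢0 , n<len , poly ← eval-isPolynomial cs nonzero =
    ℕₚ.≤-<-trans (root-bound a≢0 poly unique roots) n<len

  eval-homo : ∀ {h} → IsRingEndomorphism h → ∀ {cs} → All (λ c → h c ≡ c) cs →
              ∀ x → h (eval cs x) ≡ eval cs (h x)
  eval-homo H [] x = IsRingEndomorphism.0-homo H
  eval-homo {h} H {c ∷ cs} (hc≡c ∷ fixed) x = begin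
    h (c + x * eval cs x)          ≡⟨ IsRingEndomorphism.+-homo H c _ ⟩
    h c + h (x * eval cs x)        ≡⟨ cong (h c +_) (IsRingEndomorphism.*-homo H x _) ⟩
    h c + h x * h (eval cs x)      ≡⟨ cong₂ (λ u v → u + h x * v) hc≡c (eval-homo H fixed x) ⟩
    c + h x * eval cs (h x)        ∎

  private
    differences : List A → List A → List A
    differences = List.zipWith (λ a b → a + - b)

    length-differences : ∀ as bs → length as ≡ length bs → length (differences as bs) ≡ length as
    length-differences [] [] _ = refl
    length-differences (a ∷ as) (b ∷ bs) len≡ = cong suc (length-differences as bs (ℕₚ.suc-injective len≡))

    differences-nonzero : ∀ as bs → length as ≡ length bs → as ≢ bs → Any (_≢ 0#) (differences as bs)
    differences-nonzero [] [] _ as≢bs = contradiction refl as≢bs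
    differences-nonzero (a ∷ as) (b ∷ bs) len≡ a∷as≢b∷bs with a ≟ b
    ... | yes refl = there (differences-nonzero as bs (ℕₚ.suc-injective len≡) (a∷as≢b∷bs ∘ cong (a ∷_)))
    ... | no a≢b = here (a≢b ∘ x∙y⁻¹≈ε⇒x≈y a b)

    eval-differences : ∀ as bs → length as ≡ length bs → ∀ x →
                       eval (differences as bs) x ≡ eval as x + - eval bs x
    eval-differences [] [] _ x = sym (trans (cong (0# +_) -0#≈0#) (+-identityʳ 0#))
    eval-differences (a ∷ as) (b ∷ bs) len≡ x = begin
      (a + - b) + x * eval (differences as bs) x
        ≡⟨ cong (λ v → (a + - b) + x * v) (eval-differences as bs (ℕₚ.suc-injective len≡) x) ⟩
      (a + - b) + x * (eval as x + - eval bs x)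
        ≡⟨ solve 5 (λ a b x u v → (a :- b) :+ x :* (u :- v) := (a :+ x :* u) :- (b :+ x :* v))
             refl a b x (eval as x) (eval bs x) ⟩
      (a + x * eval as x) + - (b + x * eval bs x) ∎

  agreement-bound : ∀ {as bs} → length as ≡ length bs → as ≢ bs →
                    ∀ {rs} → Unique rs → All (λ r → eval as r ≡ eval bs r) rs → length rs < length as
  agreement-bound {as} {bs} len≡ as≢bs unique agree =
    subst (_ <_) (length-differences as bs len≡)
      (eval-root-bound (differences-nonzero as bs len≡ as≢bs) unique
        (All.map (λ {r} as≡bs → trans (eval-differences as bs len≡ r) (x≈y⇒x∙y⁻¹≈ε as≡bs)) agree))

module FiniteField (p d : ℕ) (p-prime : Prime p) (F : FieldOfOrder (p ℕ.^ d)) where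

  A : Set
  A = Fin (p ℕ.^ d)

  open FieldProperties F Fin._≟_ public
  open CommutativeRing ring using (+-commutativeMonoid; +-monoid; commutativeSemiring; semiring)
  open ≡-Reasoning

  2≤p : 2 ≤ p
  2≤p = ℕ.nonTrivial⇒n>1 p {{prime⇒nonTrivial p-prime}}

  -- Summing all elements before and after the translation x ↦ x + 1 gives the same total.
  order·1≡0 : (p ℕ.^ d) · 1# ≡ 0#
  order·1≡0 = +-identityʳ-unique S _ (sym (begin
    S                                ≡⟨ sum-permute id translation ⟩
    ∑ (λ x → x + 1#)                 ≡⟨ ∑-distrib-+ id (λ _ → 1#) ⟩
    S + ∑ (λ (_ : A) → 1#)           ≡⟨ cong (S +_) (sum-replicate (p ℕ.^ d)) ⟩
    S + (p ℕ.^ d) · 1#               ∎))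
    where
    open import Algebra.Properties.CommutativeMonoid.Sum +-commutativeMonoid
      using (sum-permute; ∑-distrib-+; sum-replicate) renaming (sum to ∑)
    S = ∑ id
    translation = permutation (_+ 1#) (_+ - 1#)
      (λ y → solve 2 (λ y o → (y :- o) :+ o := y) refl y 1#)
      (λ x → solve 2 (λ x o → (x :+ o) :- o := x) refl x 1#)

  p·1≡0 : p · 1# ≡ 0#
  p·1≡0 = x^k≡0⇒x≡0 d (trans (·1-^ p d) order·1≡0)

  ·1≢0 : ∀ {k} → 0 < k → k < p → k · 1# ≢ 0#
  ·1≢0 {k@(suc _)} _ k<p k·1≡0 with coprime-Bézout (prime⇒coprime p-prime k<p)
  ... | Bézout.+- x y 1+yk≡xp = 1+a≡b∧a·1≡0⇒b·1≢0 1+yk≡xp (m*n·1≡0 y k·1≡0) (m*n·1≡0 x p·1≡0)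
  ... | Bézout.-+ x y 1+xp≡yk = 1+a≡b∧a·1≡0⇒b·1≢0 1+xp≡yk (m*n·1≡0 x p·1≡0) (m*n·1≡0 y k·1≡0)

  ·1-strictly-injective : ∀ {m n} → m < n → n < p → m · 1# ≢ n · 1#
  ·1-strictly-injective {m} {n} m<n n<p m·1≡n·1 =
    ·1≢0 (ℕₚ.m<n⇒0<n∸m m<n) (ℕₚ.≤-<-trans (ℕₚ.m∸n≤m n m) n<p) (+-identityʳ-unique (m · 1#) _ (begin
      m · 1# + (n ℕ.∸ m) · 1#  ≡⟨ sym (×-homo-+ 1# m (n ℕ.∸ m)) ⟩
      (m ℕ.+ (n ℕ.∸ m)) · 1#   ≡⟨ cong (_· 1#) (ℕₚ.m+[n∸m]≡n (ℕₚ.<⇒≤ m<n)) ⟩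
      n · 1#                   ≡⟨ sym m·1≡n·1 ⟩
      m · 1#                   ∎))

  embed : Fin p → A
  embed a = toℕ a · 1#

  embed-injective : ∀ {a b} → embed a ≡ embed b → a ≡ b
  embed-injective {a} {b} eq with ℕₚ.<-cmp (toℕ a) (toℕ b)
  ... | tri≈ _ a≡b _ = Finₚ.toℕ-injective a≡b
  ... | tri< a<b _ _ = contradiction eq (·1-strictly-injective a<b (Finₚ.toℕ<n b))
  ... | tri> _ _ b<a = contradiction (sym eq) (·1-strictly-injective b<a (Finₚ.toℕ<n a))

  frobenius-+ : ∀ x y → (x + y) ^ p ≡ x ^ p + y ^ p
  frobenius-+ x y = trans (Binomial.theorem p x y) (expansion p refl)
    where
    import Algebra.Properties.CommutativeSemiring.Binomial commutativeSemiring as Binomial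
    open import Algebra.Properties.Monoid.Sum +-monoid
      using (sum-init-last; sum-cong-≗; sum-replicate-zero) renaming (sum to ∑)
    pCk·w≡0 : ∀ {k} → 0 < k → k < p → ∀ w → (p C k) · w ≡ 0#
    pCk·w≡0 {k} 0<k k<p with divides q pCk≡qp ← prime∣pCk p-prime 0<k k<p =
      n·1≡0⇒n·x≡0 {p C k} (subst (λ n → n · 1# ≡ 0#) (sym pCk≡qp) (m*n·1≡0 q p·1≡0))
    expansion : ∀ n → n ≡ p → Binomial.binomialExpansion x y n ≡ x ^ n + y ^ n
    expansion zero refl = contradiction 2≤p λ ()
    expansion (suc m) refl = begin
      t Fin.zero + ∑ (λ j → t (Fin.suc j))
        ≡⟨ cong (t Fin.zero +_) (sum-init-last (λ j → t (Fin.suc j))) ⟩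
      t Fin.zero + (∑ (λ j → t (Fin.suc (Fin.inject₁ j))) + t (Fin.suc (Fin.fromℕ m)))
        ≡⟨ cong₂ (λ a b → t Fin.zero + (a + b)) middle-terms last-term ⟩
      t Fin.zero + (0# + x ^ suc m)
        ≡⟨ cong₂ _+_ first-term (+-identityˡ _) ⟩
      y ^ suc m + x ^ suc m
        ≡⟨ +-comm _ _ ⟩
      x ^ suc m + y ^ suc m ∎
      where
      t = Binomial.binomialTerm x y (suc m)
      middle-terms : ∑ (λ j → t (Fin.suc (Fin.inject₁ j))) ≡ 0#
      middle-terms = trans (sum-cong-≗ (λ j → pCk·w≡0 (s≤s z≤n)
          (s≤s (subst (_< m) (sym (Finₚ.toℕ-inject₁ j)) (Finₚ.toℕ<n j))) _))
        (sum-replicate-zero m)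
      last-term : t (Fin.suc (Fin.fromℕ m)) ≡ x ^ suc m
      last-term = begin
        (suc m C suc (toℕ (Fin.fromℕ m))) · (x ^ suc (toℕ (Fin.fromℕ m)) * y ^ (m ℕ.∸ toℕ (Fin.fromℕ m)))
          ≡⟨ cong (λ k → (suc m C suc k) · (x ^ suc k * y ^ (m ℕ.∸ k))) (Finₚ.toℕ-fromℕ m) ⟩
        (suc m C suc m) · (x ^ suc m * y ^ (m ℕ.∸ m))
          ≡⟨ cong₂ (λ c k → c · (x ^ suc m * y ^ k)) (nCn≡1 (suc m)) (ℕₚ.n∸n≡0 m) ⟩
        1 · (x ^ suc m * 1#)  ≡⟨ +-identityʳ _ ⟩
        x ^ suc m * 1#        ≡⟨ *-identityʳ _ ⟩
        x ^ suc m             ∎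
      first-term : t Fin.zero ≡ y ^ suc m
      first-term = trans (+-identityʳ _) (*-identityˡ _)

  frobenius-isRingEndomorphism : IsRingEndomorphism (_^ p)
  frobenius-isRingEndomorphism = record
    { +-homo = frobenius-+ ; *-homo = λ x y → ^-distrib-* commutativeSemiring x y p ; 1-homo = 1^n≡1 p }

  frobenius^ : ℕ → A → A
  frobenius^ zero x = x
  frobenius^ (suc i) x = frobenius^ i x ^ p

  frobenius^-isRingEndomorphism : ∀ i → IsRingEndomorphism (frobenius^ i)
  frobenius^-isRingEndomorphism zero = id-isRingEndomorphism
  frobenius^-isRingEndomorphism (suc i) =
    ∘-isRingEndomorphism frobenius-isRingEndomorphism (frobenius^-isRingEndomorphism i)

  frobenius^-+ : ∀ i j x → frobenius^ (i ℕ.+ j) x ≡ frobenius^ i (frobenius^ j x)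
  frobenius^-+ zero j x = refl
  frobenius^-+ (suc i) j x = cong (_^ p) (frobenius^-+ i j x)

  frobenius^-≡-^ : ∀ i x → frobenius^ i x ≡ x ^ (p ℕ.^ i)
  frobenius^-≡-^ zero x = sym (*-identityʳ x)
  frobenius^-≡-^ (suc i) x = begin
    frobenius^ i x ^ p          ≡⟨ cong (_^ p) (frobenius^-≡-^ i x) ⟩
    (x ^ (p ℕ.^ i)) ^ p         ≡⟨ ^-assocʳ x (p ℕ.^ i) p ⟩
    x ^ (p ℕ.^ i ℕ.* p)         ≡⟨ cong (x ^_) (ℕₚ.*-comm (p ℕ.^ i) p) ⟩
    x ^ (p ℕ.^ suc i)           ∎
    where open import Algebra.Properties.Semiring.Exp semiring using (^-assocʳ)

  Fixed : ℕ → A → Set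
  Fixed i u = frobenius^ i u ≡ u

  fixed-*ˡ : ∀ {i u} → Fixed i u → ∀ k → Fixed (k ℕ.* i) u
  fixed-*ˡ fixed zero = refl
  fixed-*ˡ {i} {u} fixed (suc k) = trans (frobenius^-+ i (k ℕ.* i) u)
    (trans (cong (frobenius^ i) (fixed-*ˡ fixed k)) fixed)

  fixed-∸ : ∀ {a b u} → Fixed (a ℕ.+ b) u → Fixed b u → Fixed a u
  fixed-∸ {a} {b} {u} fixed-a+b fixed-b =
    trans (cong (frobenius^ a) (sym fixed-b)) (trans (sym (frobenius^-+ a b u)) fixed-a+b)

  fixed-gcd : ∀ {i j u} → Fixed i u → Fixed j u → Fixed (gcd i j) u
  fixed-gcd {i} {j} {u} fixed-i fixed-j with Bézout.identity (gcd-GCD i j)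
  ... | Bézout.+- x y g+yj≡xi = fixed-∸ {gcd i j} {y ℕ.* j}
    (subst (λ n → Fixed n u) (sym g+yj≡xi) (fixed-*ˡ fixed-i x)) (fixed-*ˡ fixed-j y)
  ... | Bézout.-+ x y g+xi≡yj = fixed-∸ {gcd i j} {x ℕ.* i}
    (subst (λ n → Fixed n u) (sym g+xi≡yj) (fixed-*ˡ fixed-j y)) (fixed-*ˡ fixed-i x)

  fixed-of-≡ : ∀ {i j u} → i ≤ j → frobenius^ j u ≡ frobenius^ i u → Fixed (j ℕ.∸ i) u
  fixed-of-≡ {i} {j} {u} i≤j eq = IsRingEndomorphism.injective (frobenius^-isRingEndomorphism i) (begin
    frobenius^ i (frobenius^ (j ℕ.∸ i) u)   ≡⟨ sym (frobenius^-+ i (j ℕ.∸ i) u) ⟩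
    frobenius^ (i ℕ.+ (j ℕ.∸ i)) u          ≡⟨ cong (λ n → frobenius^ n u) (ℕₚ.m+[n∸m]≡n i≤j) ⟩
    frobenius^ j u                          ≡⟨ eq ⟩
    frobenius^ i u                          ∎)

  fixed-points-bound : ∀ {i} → 1 ≤ i → ∀ {ys} → Unique ys → All (Fixed i) ys → length ys ≤ p ℕ.^ i
  fixed-points-bound {suc i} _ unique fixed =
    x^q≡x-root-bound 2≤p^[1+i] unique (All.map (λ {y} → trans (sym (frobenius^-≡-^ (suc i) y))) fixed)
    where
    2≤p^[1+i] : 2 ≤ p ℕ.^ suc i
    2≤p^[1+i] = ℕₚ.≤-trans 2≤p (ℕₚ.m≤m*n p (p ℕ.^ i) {{ℕₚ.m^n≢0 p i {{prime⇒nonZero p-prime}}}})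

  endomorphism⇒aut : ∀ {h} → IsRingEndomorphism h → Aut F
  endomorphism⇒aut {h} H = record
    { σ = h ; σ⁻¹ = λ y → proj₁ (onto y)
    ; left = λ x → injective (proj₂ (onto (h x))) ; right = λ y → proj₂ (onto y)
    ; pres+ = +-homo ; pres* = *-homo ; pres1 = 1-homo }
    where
    open IsRingEndomorphism H
    onto = injective⇒surjective h injective

  frobenius^-aut : ℕ → Aut F
  frobenius^-aut i = endomorphism⇒aut (frobenius^-isRingEndomorphism i)

  coefficients : ∀ k → Fin (p ℕ.^ k) → List A
  coefficients k i = map embed (digits k i)

  length-coefficients : ∀ k i → length (coefficients k i) ≡ k
  length-coefficients k i = trans (Listₚ.length-map embed (digits k i)) (length-digits k i)

  coefficients-injective : ∀ k {i j} → coefficients k i ≡ coefficients k j → i ≡ j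
  coefficients-injective k eq = digits-injective k (Listₚ.map-injective embed-injective eq)

  eval-coefficients-homo : ∀ {h} → IsRingEndomorphism h → ∀ k i x →
                           h (eval (coefficients k i) x) ≡ eval (coefficients k i) (h x)
  eval-coefficients-homo H k i =
    eval-homo H (Allₚ.map⁺ {f = embed} (All.universal (λ a → ·1-homo (toℕ a)) (digits k i)))
    where open IsRingEndomorphism H

  Conjugate : A → A → Set
  Conjugate w y = Σ (Aut F) λ τ → y ≡ Aut.σ τ w

  collision⇒conjugates-bound : ∀ {k w i j} → i ≢ j → eval (coefficients k i) w ≡ eval (coefficients k j) w →
                               ∀ {ys} → Unique ys → All (Conjugate w) ys → length ys < k
  collision⇒conjugates-bound {k} {w} {i} {j} i≢j collision unique conjugates =
    subst (_ <_) (length-coefficients k i)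
      (agreement-bound (trans (length-coefficients k i) (sym (length-coefficients k j)))
        (i≢j ∘ coefficients-injective k) unique
        (All.map (λ (τ , y≡σw) → subst (λ y → eval (coefficients k i) y ≡ eval (coefficients k j) y)
          (sym y≡σw) (agree τ)) conjugates))
    where
    agree : ∀ τ → eval (coefficients k i) (Aut.σ τ w) ≡ eval (coefficients k j) (Aut.σ τ w)
    agree τ = begin
      eval (coefficients k i) (σ w)    ≡⟨ sym (eval-coefficients-homo (σ-isRingEndomorphism τ) k i w) ⟩
      σ (eval (coefficients k i) w)    ≡⟨ cong σ collision ⟩
      σ (eval (coefficients k j) w)    ≡⟨ eval-coefficients-homo (σ-isRingEndomorphism τ) k j w ⟩
      eval (coefficients k j) (σ w)    ∎
      where σ = Aut.σ τ

  -- There are more coefficient vectors of length d + 1 than field elements.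
  conjugates-bound : ∀ w {ys} → Unique ys → All (Conjugate w) ys → length ys ≤ d
  conjugates-bound w unique conjugates =
    let i , j , i<j , collision = Finₚ.pigeonhole p^d<p^[1+d] (λ i → eval (coefficients (suc d) i) w)
    in ℕₚ.≤-pred (collision⇒conjugates-bound (Finₚ.<⇒≢ i<j) collision unique conjugates)
    where
    p^d<p^[1+d] : p ℕ.^ d < p ℕ.^ suc d
    p^d<p^[1+d] = subst (p ℕ.^ d <_) (ℕₚ.*-comm (p ℕ.^ d) p)
      (ℕₚ.m<m*n (p ℕ.^ d) p {{ℕₚ.m^n≢0 p d {{prime⇒nonZero p-prime}}}} 2≤p)

  Generic : A → Set
  Generic z = ∀ {i} → 0 < i → i < d → ¬ Fixed i z

  -- Elements fixed by some frobenius^ i with 0 < i < d number at most Σ pⁱ < p^d.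
  generic-exists : 0 < d → ∃ Generic
  generic-exists 0<d = from-decision (Finₚ.any? (λ z → ¬? (Any.any? (λ i → frobenius^ i z Fin.≟ z) indices)))
    where
    indices = List.applyDownFrom suc (ℕ.pred d)
    ∈-indices : ∀ {i} → 0 < i → i < d → i ∈ indices
    ∈-indices 0<i i<d = ∈-applyDownFrom-suc⁺ (ℕ.pred d) 0<i (ℕₚ.<⇒≤pred i<d)
    from-decision : Dec (∃ λ z → ¬ Any (λ i → Fixed i z) indices) → ∃ Generic
    from-decision (yes (z , unfixed)) = z , λ 0<i i<d fixed → unfixed (lose (∈-indices 0<i i<d) fixed)
    from-decision (no ∄unfixed) = contradiction covered (ℕₚ.<⇒≱ (sum-p^i<p^n 2≤p 0<d))
      where
      covered : p ℕ.^ d ≤ sum (List.map (p ℕ.^_) indices)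
      covered = subst (_≤ sum (List.map (p ℕ.^_) indices)) (Listₚ.length-tabulate {n = p ℕ.^ d} id)
        (union-bound Fixed (λ i z → frobenius^ i z Fin.≟ z) (p ℕ.^_) indices
          (λ i∈ → fixed-points-bound (proj₁ (∈-applyDownFrom-suc⁻ (ℕ.pred d) i∈)))
          (Uniqueₚ.allFin⁺ (p ℕ.^ d))
          (All.universal (λ z → decidable-stable (Any.any? (λ i → frobenius^ i z Fin.≟ z) indices)
            (λ unfixed → ∄unfixed (z , unfixed))) (List.allFin (p ℕ.^ d))))

  module GenericElement {z} (z-generic : Generic z) where

    open import Data.List.Membership.DecPropositional (Fin._≟_ {p ℕ.^ d}) using (_∈?_)

    orbit : List A
    orbit = List.applyUpTo (λ i → frobenius^ i z) d

    length-orbit : length orbit ≡ d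
    length-orbit = Listₚ.length-applyUpTo _ d

    orbit-unique : Unique orbit
    orbit-unique = Uniqueₚ.applyUpTo⁺₁ _ d λ {i} {j} i<j j<d eq →
      z-generic (ℕₚ.m<n⇒0<n∸m i<j) (ℕₚ.≤-<-trans (ℕₚ.m∸n≤m j i) j<d) (fixed-of-≡ (ℕₚ.<⇒≤ i<j) (sym eq))

    orbit-conjugates : All (Conjugate z) orbit
    orbit-conjugates = All.tabulate λ {y} y∈ →
      let i , _ , y≡ = Membershipₚ.∈-applyUpTo⁻ (λ i → frobenius^ i z) y∈ in frobenius^-aut i , y≡

    conjugate⇒∈orbit : ∀ {y} → Conjugate z y → y ∈ orbit
    conjugate⇒∈orbit {y} conjugate with y ∈? orbit
    ... | yes y∈ = y∈
    ... | no y∉ = contradiction (subst (_≤ d) (cong suc length-orbit)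
          (conjugates-bound z (All.tabulate (λ w∈ y≡w → y∉ (subst (_∈ orbit) (sym y≡w) w∈)) ∷ orbit-unique)
            (conjugate ∷ orbit-conjugates))) ℕₚ.1+n≰n

    -- The d conjugates of z are roots of no nonzero polynomial of degree < d, so z generates F.
    eval-at-z-surjective : ∀ v → ∃ λ i → eval (coefficients d i) z ≡ v
    eval-at-z-surjective = injective⇒surjective _ λ {i} {j} collision → decidable-stable (i Fin.≟ j) λ i≢j →
      ℕₚ.<-irrefl length-orbit (collision⇒conjugates-bound i≢j collision orbit-unique orbit-conjugates)

    aut≡frobenius^ : ∀ τ → ∃ λ i → i < d × ∀ v → Aut.σ τ v ≡ frobenius^ i v
    aut≡frobenius^ τ with i , i<d , σz≡φz ← Membershipₚ.∈-applyUpTo⁻ _ (conjugate⇒∈orbit (τ , refl)) =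
      i , i<d , λ v → let k , e[k]≡v = eval-at-z-surjective v in
        subst (λ v → Aut.σ τ v ≡ frobenius^ i v) e[k]≡v (agree k)
      where
      agree : ∀ k → Aut.σ τ (eval (coefficients d k) z) ≡ frobenius^ i (eval (coefficients d k) z)
      agree k = begin
        Aut.σ τ (eval (coefficients d k) z)       ≡⟨ eval-coefficients-homo (σ-isRingEndomorphism τ) d k z ⟩
        eval (coefficients d k) (Aut.σ τ z)       ≡⟨ cong (eval (coefficients d k)) σz≡φz ⟩
        eval (coefficients d k) (frobenius^ i z)
          ≡⟨ eval-coefficients-homo (frobenius^-isRingEndomorphism i) d k z ⟨
        frobenius^ i (eval (coefficients d k) z)  ∎

    fixed-d : ∀ v → Fixed d v
    fixed-d v with aut≡frobenius^ (frobenius^-aut d)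
    ... | zero , _ , frobenius^d≡id = frobenius^d≡id v
    ... | suc i , 1+i<d , frobenius^d≡frobenius^[1+i] = contradiction
      (fixed-of-≡ (ℕₚ.<⇒≤ 1+i<d) (frobenius^d≡frobenius^[1+i] z))
      (z-generic (ℕₚ.m<n⇒0<n∸m 1+i<d) (ℕₚ.∸-monoʳ-< (s≤s z≤n) (ℕₚ.<⇒≤ 1+i<d)))

    generic-≢0 : 1 < d → z ≢ 0#
    generic-≢0 1<d z≡0 = z-generic (s≤s z≤n) 1<d (begin
      frobenius^ 1 z   ≡⟨ cong (frobenius^ 1) z≡0 ⟩
      frobenius^ 1 0#  ≡⟨ IsRingEndomorphism.0-homo (frobenius^-isRingEndomorphism 1) ⟩
      0#               ≡⟨ z≡0 ⟨
      z                ∎)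

    conjugate⇔∈orbit : ∀ y → Conjugate z y ⇔ y ∈ orbit
    conjugate⇔∈orbit y = mk⇔ conjugate⇒∈orbit (All.lookup orbit-conjugates)

  aut≡frobenius^ : 0 < d → ∀ τ → ∃ λ i → i < d × ∀ v → Aut.σ τ v ≡ frobenius^ i v
  aut≡frobenius^ 0<d = GenericElement.aut≡frobenius^ (proj₂ (generic-exists 0<d))

  fixed-d : 0 < d → ∀ v → Fixed d v
  fixed-d 0<d = GenericElement.fixed-d (proj₂ (generic-exists 0<d))

  rel-identity : ∀ x y → Rel F x y x y
  rel-identity x y = 1# , frobenius^-aut 0 , 1≢0 , sym (*-identityˡ x) , sym (*-identityˡ y)

  rel-≢0ˡ : ∀ {x y α β} → x ≢ 0# → Rel F x y α β → α ≢ 0#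
  rel-≢0ˡ x≢0 (a , τ , a≢0 , α≡ , _) α≡0 = *-≢0 a≢0 (σ-≢0 τ x≢0) (trans (sym α≡) α≡0)

  rel-1y1⇔conjugate : ∀ y β → Rel F 1# y 1# β ⇔ Conjugate y β
  rel-1y1⇔conjugate y β = mk⇔
    (λ (a , τ , _ , 1≡a*σ1 , β≡a*σy) → τ , (begin
      β                        ≡⟨ β≡a*σy ⟩
      a * Aut.σ τ y            ≡⟨ cong (_* Aut.σ τ y) (*-identityʳ a) ⟨
      a * 1# * Aut.σ τ y       ≡⟨ cong (λ t → a * t * Aut.σ τ y) (Aut.pres1 τ) ⟨
      a * Aut.σ τ 1# * Aut.σ τ y ≡⟨ cong (_* Aut.σ τ y) 1≡a*σ1 ⟨
      1# * Aut.σ τ y           ≡⟨ *-identityˡ _ ⟩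
      Aut.σ τ y                ∎))
    (λ (τ , β≡σy) → 1# , τ , 1≢0 ,
      trans (sym (Aut.pres1 τ)) (sym (*-identityˡ _)) , trans β≡σy (sym (*-identityˡ _)))

  rel⇒conjugate : ∀ {x y α β} (x≢0 : x ≢ 0#) (α≢0 : α ≢ 0#) → Rel F x y α β →
                  Conjugate (y * inv x x≢0) (β * inv α α≢0)
  rel⇒conjugate {x} {y} {α} {β} x≢0 α≢0 (a , τ , _ , α≡ , β≡) = τ , *-cancelʳ α≢0 (begin
    (β * α⁻¹) * α                  ≡⟨ *-assoc β α⁻¹ α ⟩
    β * (α⁻¹ * α)                  ≡⟨ cong (β *_) (inv-inverseˡ α α≢0) ⟩
    β * 1#                         ≡⟨ *-identityʳ β ⟩
    β                              ≡⟨ β≡ ⟩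
    a * σ y                        ≡⟨ sym (*-identityʳ _) ⟩
    (a * σ y) * 1#                 ≡⟨ cong ((a * σ y) *_) (sym σx⁻¹*σx≡1) ⟩
    (a * σ y) * (σ x⁻¹ * σ x)      ≡⟨ solve 4 (λ a Y I X → (a :* Y) :* (I :* X) := (Y :* I) :* (a :* X))
                                        refl a (σ y) (σ x⁻¹) (σ x) ⟩
    (σ y * σ x⁻¹) * (a * σ x)      ≡⟨ cong₂ _*_ (sym (Aut.pres* τ y x⁻¹)) (sym α≡) ⟩
    σ (y * x⁻¹) * α                ∎)
    where
    σ = Aut.σ τ
    x⁻¹ = inv x x≢0
    α⁻¹ = inv α α≢0
    σx⁻¹*σx≡1 : σ x⁻¹ * σ x ≡ 1#
    σx⁻¹*σx≡1 = trans (sym (Aut.pres* τ x⁻¹ x)) (trans (cong σ (inv-inverseˡ x x≢0)) (Aut.pres1 τ))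

  -- β ↦ β / α maps the β related to α injectively into the conjugates of y / x.
  valency≤d : ∀ {x y α} → x ≢ 0# → α ≢ 0# → ∀ {βs} → Unique βs → All (Rel F x y α) βs → length βs ≤ d
  valency≤d {x} {y} {α} x≢0 α≢0 {βs} unique related =
    subst (_≤ d) (Listₚ.length-map (_* inv α α≢0) βs)
      (conjugates-bound _ (Uniqueₚ.map⁺ (*-cancelʳ (inv-≢0 α α≢0)) unique)
        (Allₚ.map⁺ (All.map (rel⇒conjugate x≢0 α≢0) related)))

  Twisted : ℕ → A → A → A → Set
  Twisted i α β γ = frobenius^ i γ * α ≡ γ * frobenius^ i β

  twisted-ratio-fixed : ∀ {i α β γ γ₀} (γ₀≢0 : γ₀ ≢ 0#) → α ≢ 0# →
                        Twisted i α β γ → Twisted i α β γ₀ → Fixed i (γ * inv γ₀ γ₀≢0)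
  twisted-ratio-fixed {i} {α} {β} {γ} {γ₀} γ₀≢0 α≢0 twisted twisted₀ = *-cancelʳ M≢0 (begin
    φ (γ * γ₀⁻¹) * M                    ≡⟨ cong (_* M) (*-homo γ γ₀⁻¹) ⟩
    (φ γ * φ γ₀⁻¹) * M                  ≡⟨ solve 5 (λ Fg Fi G₀ g₀ a → (Fg :* Fi) :* ((G₀ :* g₀) :* a)
                                              := ((Fg :* a) :* g₀) :* (Fi :* G₀))
                                            refl (φ γ) (φ γ₀⁻¹) (φ γ₀) γ₀ α ⟩
    ((φ γ * α) * γ₀) * (φ γ₀⁻¹ * φ γ₀)  ≡⟨ cong₂ (λ u v → (u * γ₀) * v) twisted φγ₀⁻¹*φγ₀≡1 ⟩
    ((γ * φ β) * γ₀) * 1#               ≡⟨ solve 3 (λ g b g₀ → ((g :* b) :* g₀) := g :* (g₀ :* b))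
                                            refl γ (φ β) γ₀ |> cong (_* 1#) ⟩
    (γ * (γ₀ * φ β)) * 1#               ≡⟨ cong₂ (λ u v → (γ * u) * v) twisted₀ (inv-inverseˡ γ₀ γ₀≢0) ⟨
    (γ * (φ γ₀ * α)) * (γ₀⁻¹ * γ₀)      ≡⟨ solve 5 (λ g G₀ a I g₀ → (g :* (G₀ :* a)) :* (I :* g₀)
                                              := (g :* I) :* ((G₀ :* g₀) :* a))
                                            refl γ (φ γ₀) α γ₀⁻¹ γ₀ ⟩
    (γ * γ₀⁻¹) * M                      ∎)
    where
    open IsRingEndomorphism (frobenius^-isRingEndomorphism i)
    φ = frobenius^ i
    γ₀⁻¹ = inv γ₀ γ₀≢0
    M = (φ γ₀ * γ₀) * α
    M≢0 : M ≢ 0#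
    M≢0 = *-≢0 (*-≢0 (σ-≢0 (frobenius^-aut i) γ₀≢0) γ₀≢0) α≢0
    φγ₀⁻¹*φγ₀≡1 : φ γ₀⁻¹ * φ γ₀ ≡ 1#
    φγ₀⁻¹*φγ₀≡1 = trans (sym (*-homo γ₀⁻¹ γ₀)) (trans (cong φ (inv-inverseˡ γ₀ γ₀≢0)) 1-homo)

  -- The ratios γ / γ₀ together with 0 are distinct fixed points of frobenius^ (gcd i d).
  twisted-bound : 0 < d → ∀ {i α β} → 0 < i → α ≢ 0# → ∀ {γs} → Unique γs →
                  All (λ γ → γ ≢ 0# × Twisted i α β γ) γs → length γs ≤ p ℕ.^ gcd i d ℕ.∸ 1
  twisted-bound 0<d {i} 0<i α≢0 {[]} _ _ = z≤n
  twisted-bound 0<d {i} {α} {β} 0<i α≢0 {γs@(γ₀ ∷ _)} unique twisted@((γ₀≢0 , twisted₀) ∷ _) =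
    subst (λ n → n ℕ.∸ 1 ≤ p ℕ.^ gcd i d ℕ.∸ 1) (cong suc (Listₚ.length-map ratio γs))
      (ℕₚ.∸-monoˡ-≤ 1 (fixed-points-bound 1≤gcd ratios-unique ratios-fixed))
    where
    ratio : A → A
    ratio γ = γ * inv γ₀ γ₀≢0
    1≤gcd : 1 ≤ gcd i d
    1≤gcd = ℕₚ.n≢0⇒n>0 (gcd[m,n]≢0 i d (inj₁ (ℕₚ.>⇒≢ 0<i)))
    ratios-unique : Unique (0# ∷ List.map ratio γs)
    ratios-unique =
      Allₚ.map⁺ (All.map (λ (γ≢0 , _) 0≡ratio → *-≢0 γ≢0 (inv-≢0 γ₀ γ₀≢0) (sym 0≡ratio)) twisted)
      ∷ Uniqueₚ.map⁺ (*-cancelʳ (inv-≢0 γ₀ γ₀≢0)) unique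
    ratios-fixed : All (Fixed (gcd i d)) (0# ∷ List.map ratio γs)
    ratios-fixed =
      IsRingEndomorphism.0-homo (frobenius^-isRingEndomorphism (gcd i d))
      ∷ Allₚ.map⁺ (All.map (λ {γ} (_ , twistedγ) →
          fixed-gcd {i} {d} (twisted-ratio-fixed {i} {α} {β} γ₀≢0 α≢0 twistedγ twisted₀)
            (fixed-d 0<d (ratio γ))) twisted)

  -- Applied to (γ, α), SameRel gives γ = a σ γ and α = a σ β with σ = frobenius^ i; σ = id would make α = β.
  same-rel⇒twisted : 0 < d → ∀ {x y α β γ} → Irreflexive F (Rel F x y) → Rel F x y α β →
                     γ ≢ 0# → SameRel F γ α β → ∃ λ i → 0 < i × i < d × Twisted i α β γ
  same-rel⇒twisted 0<d {x} {y} {α} {β} {γ} irreflexive xy-αβ γ≢0 same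
    with a , τ , _ , γ≡ , α≡ ← Equivalence.to (same γ α) (rel-identity γ α)
    with aut≡frobenius^ 0<d τ
  ... | zero , _ , σ≡id = contradiction (subst (Rel F x y α) (sym α≡β) xy-αβ) (irreflexive α)
    where
    a≡1 : a ≡ 1#
    a≡1 = sym (*-cancelˡ γ≢0 (begin
      γ * 1#  ≡⟨ *-identityʳ γ ⟩
      γ       ≡⟨ trans γ≡ (cong (a *_) (σ≡id γ)) ⟩
      a * γ   ≡⟨ *-comm a γ ⟩
      γ * a   ∎))
    α≡β : α ≡ β
    α≡β = trans α≡ (trans (cong₂ _*_ a≡1 (σ≡id β)) (*-identityˡ β))
  ... | suc i , 1+i<d , σ≡φ = suc i , s≤s z≤n , 1+i<d , (begin
    φ γ * α                ≡⟨ cong (φ γ *_) (trans α≡ (cong (a *_) (σ≡φ β))) ⟩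
    φ γ * (a * φ β)        ≡⟨ solve 3 (λ g a b → g :* (a :* b) := (a :* g) :* b) refl (φ γ) a (φ β) ⟩
    (a * φ γ) * φ β        ≡⟨ cong (λ v → (a * v) * φ β) (sym (σ≡φ γ)) ⟩
    (a * Aut.σ τ γ) * φ β  ≡⟨ cong (_* φ β) (sym γ≡) ⟩
    γ * φ β                ∎)
    where φ = frobenius^ (suc i)

  indistinguishing≤bound : 0 < d → ∀ {x y} → x ≢ 0# → Irreflexive F (Rel F x y) →
                           ∀ {α β} → Rel F x y α β → ∀ {γs} → Unique γs →
                           All (λ γ → γ ≢ 0# × SameRel F γ α β) γs → length γs ≤ bound p d
  indistinguishing≤bound 0<d {x} {y} x≢0 irreflexive {α} {β} xy-αβ unique same =
    union-bound (λ i γ → γ ≢ 0# × Twisted i α β γ)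
      (λ i γ → ¬? (γ Fin.≟ 0#) ×-dec (frobenius^ i γ * α Fin.≟ γ * frobenius^ i β))
      (λ i → p ℕ.^ gcd i d ℕ.∸ 1) (List.drop 1 (List.upTo d))
      (λ i∈ → twisted-bound 0<d (proj₁ (∈-drop-1-upTo⁻ {d} i∈)) (rel-≢0ˡ x≢0 xy-αβ))
      unique (All.map covered same)
    where
    covered : ∀ {γ} → γ ≢ 0# × SameRel F γ α β →
              Any (λ i → γ ≢ 0# × Twisted i α β γ) (List.drop 1 (List.upTo d))
    covered (γ≢0 , sameγ) with i , 0<i , i<d , twisted ← same-rel⇒twisted 0<d irreflexive xy-αβ γ≢0 sameγ =
      lose (∈-drop-1-upTo 0<i i<d) (γ≢0 , twisted)

-- From here on _^_ is exponentiation in ℕ rather than in F.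
open import Data.Nat using (_^_)

lemma6p1 : (p d : ℕ) → Prime p → 2 ≤ d → (F : FieldOfOrder (p ^ d)) →
    -- maximal valency k = d : every valency is ≤ d ...
    ((∀ (x y α : Fin (p ^ d)) → x ≢ IsFieldOn.0F F → y ≢ IsFieldOn.0F F →
        α ≢ IsFieldOn.0F F → Σ (Fin (p ^ d)) (λ β → Rel F x y α β) →
        ∀ m → HasSize (λ β → Rel F x y α β) m → m ≤ d)
    -- ... and some basis relation has valency exactly d
    × Σ (Fin (p ^ d)) (λ x → Σ (Fin (p ^ d)) λ y → Σ (Fin (p ^ d)) λ α →
        (x ≢ IsFieldOn.0F F) × (y ≢ IsFieldOn.0F F) × (α ≢ IsFieldOn.0F F) ×
        Σ (Fin (p ^ d)) (λ β → Rel F x y α β) ×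
        HasSize (λ β → Rel F x y α β) d))
    -- indistinguishing number c ≤ Σ_{i=1}^{d-1} (p^gcd(i,d) - 1)
    × (∀ (x y : Fin (p ^ d)) → x ≢ IsFieldOn.0F F → y ≢ IsFieldOn.0F F →
        Irreflexive F (Rel F x y) →
        ∀ α β → Rel F x y α β →
        ∀ m → HasSize (λ γ → (γ ≢ IsFieldOn.0F F) × SameRel F γ α β) m →
        m ≤ bound p d)
lemma6p1 p d p-prime 2≤d F =
  ( (λ x y α x≢0 _ α≢0 _ m → hasSize-bound (valency≤d x≢0 α≢0))
  , (1# , z , 1# , 1≢0 , generic-≢0 2≤d , 1≢0 , (z , rel-identity 1# z) ,
     orbit , length-orbit , orbit-unique , λ β → ⇔-trans (rel-1y1⇔conjugate z β) (conjugate⇔∈orbit β)) )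
  , λ x y x≢0 _ irreflexive α β xy-αβ m → hasSize-bound (indistinguishing≤bound 0<d x≢0 irreflexive xy-αβ)
  where
  open FiniteField p d p-prime F
  0<d : 0 < d
  0<d = ℕₚ.<-trans (s≤s z≤n) 2≤d
  z : A
  z = proj₁ (generic-exists 0<d)
  open GenericElement (proj₂ (generic-exists 0<d))
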